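{- Let $G=(X,Y,E)$ be a $P_8$-free bipartite graph, let $N_0\subseteq X\cup Y$ be a nonempty vertex set, and for $i\ge 1$ let $N_i$ be the set of vertices at distance exactly $i$ from $N_0$. Assume that every vertex $u\in N_2$ is an endpoint of an induced $P_5$ in $G$ whose other four vertices all lie in $N_0\cup N_1$. Then: (i) no vertex $u\in N_2$ is an endpoint of an induced $P_4$ in $G$ whose other three vertices all lie in $\bigcup_{i\ge 3}N_i$; (ii) $N_5=\emptyset$, $N_4$ is an independent set, and for every edge $ab$ with $a,b\in N_3$, neither $a$ nor $b$ has a neighbor in $N_4$.
   Context: $P_k$ denotes the chordless path on $k$ vertices; $G$ is $P_8$-free if it has no induced subgraph isomorphic to $P_8$. The distance of a vertex $v$ from a set $N_0$ is $\min_{w\in N_0}\mathrm{dist}_G(v,w)$. -}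

module Defs where

open import Data.Nat using (ℕ; zero; suc; _<_; _≤_)
open import Data.Fin using (Fin; toℕ)
open import Data.Bool using (Bool; true; false)
open import Data.Product using (Σ; ∃; _×_; _,_)
open import Data.Sum using (_⊎_)
open import Relation.Nullary using (¬_)
open import Relation.Binary.PropositionalEquality using (_≡_; _≢_)
open import Function.Definitions using (Injective)

record Graph (n : ℕ) : Set where
  field
    adj   : Fin n → Fin n → Bool
    sym   : ∀ u v → adj u v ≡ adj v u
    irrefl : ∀ u → adj u u ≡ false

open Graph public

-- Bipartite graph G = (X, Y, E): a side function (false = X, true = Y)
-- such that every edge joins X and Y.
IsBipartition : ∀ {n} → Graph n → (Fin n → Bool) → Set
IsBipartition G side = ∀ u v → adj G u v ≡ true → side u ≢ side v

Consecutive : ℕ → ℕ → Set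
Consecutive i j = suc i ≡ j ⊎ suc j ≡ i

IsInducedPath : ∀ {n} → Graph n → (k : ℕ) → (Fin k → Fin n) → Set
IsInducedPath G k p =
  Injective _≡_ _≡_ p ×
  (∀ i j → (adj G (p i) (p j) ≡ true → Consecutive (toℕ i) (toℕ j)) ×
           (Consecutive (toℕ i) (toℕ j) → adj G (p i) (p j) ≡ true))

PFree : ∀ {n} → ℕ → Graph n → Set
PFree k G = ¬ (Σ (Fin _ → Fin _) λ p → IsInducedPath G k p)

WalkFrom : ∀ {n} → Graph n → (Fin n → Bool) → ℕ → Fin n → Set
WalkFrom G N₀ zero v = N₀ v ≡ true
WalkFrom G N₀ (suc i) v = ∃ λ u → WalkFrom G N₀ i u × adj G u v ≡ true

-- Layer G N₀ i v : the distance of v from N₀ is exactly i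
-- (a shortest walk has length i; shortest walks are paths).
Layer : ∀ {n} → Graph n → (Fin n → Bool) → ℕ → Fin n → Set
Layer G N₀ i v = WalkFrom G N₀ i v × (∀ j → j < i → ¬ WalkFrom G N₀ j v)

-- Every vertex u of N₂ starts an induced P₅ that, apart from u, stays in N₀ ∪ N₁.
-- An induced P₄ from u whose other vertices lie at distance ≥ 3 has no edges to
-- that P₅ (layers two apart are never adjacent), so the two glue at u into an
-- induced P₈.  This is (i); (ii) follows by exhibiting such a P₄ in each case: a
-- shortest path down from a vertex of N₅, and, for the edges inside N₄ or from
-- an edge of N₃ into N₄, a path built from parents, using that a bipartite graph
-- has no triangles.
module Submission where

open import Defs
open import Data.Nat using (ℕ; zero; suc; _+_; _≤_; z≤n; s≤s)
open import Data.Nat.Properties using (≮⇒≥; ≤⇒≯; ≤-refl; <⇒≤; n≤1+n; suc-injective)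
open import Data.Fin using (Fin; zero; suc; toℕ)
open import Data.Bool using (Bool; true; false; not)
open import Data.Bool.Properties using (¬-not; not-¬; not-involutive)
open import Data.Product using (Σ; ∃; _×_; _,_; proj₁; proj₂)
open import Data.Sum using (_⊎_; inj₁; inj₂; [_,_])
import Data.Sum as Sum
open import Data.Empty using (⊥; ⊥-elim)
open import Data.Vec.Functional using (_∷_)
open import Function.Definitions using (Injective)
open import Relation.Nullary using (¬_)
open import Relation.Binary.PropositionalEquality using (_≡_; _≢_; refl; trans; cong)
import Relation.Binary.PropositionalEquality as ≡
open ≡.≡-Reasoning

Consecutive-sym : ∀ {i j} → Consecutive i j → Consecutive j i
Consecutive-sym = Sum.swap

Consecutive-suc : ∀ {i j} → Consecutive i j → Consecutive (suc i) (suc j)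
Consecutive-suc = Sum.map (cong suc) (cong suc)

Consecutive-pred : ∀ {i j} → Consecutive (suc i) (suc j) → Consecutive i j
Consecutive-pred = Sum.map suc-injective suc-injective

module _ {n} (G : Graph n) where

  adj-sym : ∀ {u v b} → adj G u v ≡ b → adj G v u ≡ b
  adj-sym {u} {v} = trans (Graph.sym G v u)

  AdjacentIff : Fin n → Fin n → ℕ → ℕ → Set
  AdjacentIff u v i j = (adj G u v ≡ true → Consecutive i j) × (Consecutive i j → adj G u v ≡ true)

  AdjacentIff-sym : ∀ {u v i j} → AdjacentIff u v i j → AdjacentIff v u j i
  AdjacentIff-sym (to , from) = (λ e → Consecutive-sym (to (adj-sym e))) , (λ c → adj-sym (from (Consecutive-sym c)))

  bipartite⇒triangle-free : ∀ {side x y z} → IsBipartition G side →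
    adj G x y ≡ true → adj G y z ≡ true → adj G x z ≡ false
  bipartite⇒triangle-free {side} {x} {y} {z} bip x~y y~z = ¬-not λ x~z → bip x z x~z (begin
    side x             ≡⟨ ¬-not (bip x y x~y) ⟩
    not (side y)       ≡⟨ cong not (¬-not (bip y z y~z)) ⟩
    not (not (side z)) ≡⟨ not-involutive (side z) ⟩
    side z             ∎)

  -- On a path with at least three vertices no extra distinctness hypothesis is
  -- needed: x = p 1 would be adjacent to p 2.
  ∷-isInducedPath : ∀ {k x} {p : Fin (3 + k) → Fin n} → IsInducedPath G (3 + k) p →
    adj G x (p zero) ≡ true → (∀ i → adj G x (p (suc i)) ≡ false) →
    IsInducedPath G (4 + k) (x ∷ p)
  ∷-isInducedPath {x = x} {p} (p-inj , p-path) x~p₀ x≁p = x∷p-inj , x∷p-path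
    where
    x≢p : ∀ j → x ≢ p j
    x≢p zero          refl = not-¬ x~p₀ (irrefl G x)
    x≢p (suc zero)    refl = not-¬ (proj₂ (p-path (suc zero) (suc (suc zero))) (inj₁ refl)) (x≁p (suc zero))
    x≢p (suc (suc j)) refl = [ (λ ()) , (λ ()) ] (proj₁ (p-path _ zero) x~p₀)

    x∷p-inj : Injective _≡_ _≡_ (x ∷ p)
    x∷p-inj {zero}  {zero}  _ = refl
    x∷p-inj {zero}  {suc j} e = ⊥-elim (x≢p j e)
    x∷p-inj {suc i} {zero}  e = ⊥-elim (x≢p i (≡.sym e))
    x∷p-inj {suc i} {suc j} e = cong suc (p-inj e)

    x-row : ∀ j → AdjacentIff x (p j) 0 (suc (toℕ j))
    x-row zero    = (λ _ → inj₁ refl) , (λ _ → x~p₀)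
    x-row (suc j) = (λ e → ⊥-elim (not-¬ e (x≁p j))) , [ (λ ()) , (λ ()) ]

    x∷p-path : ∀ i j → AdjacentIff ((x ∷ p) i) ((x ∷ p) j) (toℕ i) (toℕ j)
    x∷p-path zero    zero    = (λ e → ⊥-elim (not-¬ e (irrefl G x))) , [ (λ ()) , (λ ()) ]
    x∷p-path zero    (suc j) = x-row j
    x∷p-path (suc i) zero    = AdjacentIff-sym (x-row i)
    x∷p-path (suc i) (suc j) = let (to , from) = p-path i j in
      (λ e → Consecutive-suc (to e)) , (λ c → from (Consecutive-pred c))

  record InducedP₄ (a b c d : Fin n) : Set where
    field
      a~b : adj G a b ≡ true
      b~c : adj G b c ≡ true
      c~d : adj G c d ≡ true
      a≁c : adj G a c ≡ false
      a≁d : adj G a d ≡ false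
      b≁d : adj G b d ≡ false

  isInducedPath⇒InducedP₄ : ∀ {p} → IsInducedPath G 4 p →
    InducedP₄ (p zero) (p (suc zero)) (p (suc (suc zero))) (p (suc (suc (suc zero))))
  isInducedPath⇒InducedP₄ {p} (_ , path) = record
    { a~b = adjacent zero (suc zero) (inj₁ refl)
    ; b~c = adjacent (suc zero) (suc (suc zero)) (inj₁ refl)
    ; c~d = adjacent (suc (suc zero)) (suc (suc (suc zero))) (inj₁ refl)
    ; a≁c = nonadjacent zero (suc (suc zero)) [ (λ ()) , (λ ()) ]
    ; a≁d = nonadjacent zero (suc (suc (suc zero))) [ (λ ()) , (λ ()) ]
    ; b≁d = nonadjacent (suc zero) (suc (suc (suc zero))) [ (λ ()) , (λ ()) ]
    }
    where
    adjacent : ∀ i j → Consecutive (toℕ i) (toℕ j) → adj G (p i) (p j) ≡ true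
    adjacent i j = proj₂ (path i j)
    nonadjacent : ∀ i j → ¬ Consecutive (toℕ i) (toℕ j) → adj G (p i) (p j) ≡ false
    nonadjacent i j ¬c = ¬-not (λ e → ¬c (proj₁ (path i j) e))

  InducedP₄-∷-isInducedPath : ∀ {k x y z} {p : Fin (3 + k) → Fin n} →
    IsInducedPath G (3 + k) p → InducedP₄ (p zero) x y z →
    (∀ j → adj G x (p (suc j)) ≡ false) →
    (∀ j → adj G y (p (suc j)) ≡ false) →
    (∀ j → adj G z (p (suc j)) ≡ false) →
    IsInducedPath G (6 + k) (z ∷ y ∷ x ∷ p)
  InducedP₄-∷-isInducedPath {x = x} {y} {z} {p} p-path P x≁p y≁p z≁p =
    ∷-isInducedPath (∷-isInducedPath (∷-isInducedPath p-path (adj-sym a~b) x≁p)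
                                     (adj-sym b~c) y≁x∷p)
                    (adj-sym c~d) z≁y∷x∷p
    where
    open InducedP₄ P
    y≁x∷p : ∀ i → adj G y ((x ∷ p) (suc i)) ≡ false
    y≁x∷p zero    = adj-sym a≁c
    y≁x∷p (suc j) = y≁p j
    z≁y∷x∷p : ∀ i → adj G z ((y ∷ x ∷ p) (suc i)) ≡ false
    z≁y∷x∷p zero          = adj-sym b≁d
    z≁y∷x∷p (suc zero)    = adj-sym a≁d
    z≁y∷x∷p (suc (suc j)) = z≁p j

module _ {n} (G : Graph n) (N₀ : Fin n → Bool) where

  Near Far : Fin n → Set
  Near v = Layer G N₀ 0 v ⊎ Layer G N₀ 1 v
  Far v = ∃ λ i → 3 ≤ i × Layer G N₀ i v

  layer-adj-≤ : ∀ {i j v w} → Layer G N₀ i v → Layer G N₀ j w → adj G v w ≡ true → j ≤ suc i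
  layer-adj-≤ {i} (walk-v , _) (_ , w-shortest) v~w =
    ≮⇒≥ (λ i+1<j → w-shortest (suc i) i+1<j (_ , walk-v , v~w))

  layer-gap-nonadj : ∀ {i j v w} → Layer G N₀ i v → Layer G N₀ j w → 2 + i ≤ j → adj G v w ≡ false
  layer-gap-nonadj Lv Lw gap = ¬-not λ v~w → ≤⇒≯ (layer-adj-≤ Lv Lw v~w) gap

  layer-parent : ∀ {i v} → Layer G N₀ (suc i) v → ∃ λ u → Layer G N₀ i u × adj G u v ≡ true
  layer-parent ((u , walk-u , u~v) , v-shortest) =
    u , (walk-u , λ j j<i walk-j → v-shortest (suc j) (s≤s j<i) (_ , walk-j , u~v)) , u~v

  far-near-nonadj : ∀ {x y} → Far x → Near y → adj G x y ≡ false
  far-near-nonadj (_ , 3≤i , Lx) (inj₁ Ly) = adj-sym G (layer-gap-nonadj Ly Lx (<⇒≤ 3≤i))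
  far-near-nonadj (_ , 3≤i , Lx) (inj₂ Ly) = adj-sym G (layer-gap-nonadj Ly Lx 3≤i)

  EndOfNearP₅ : Fin n → Set
  EndOfNearP₅ u = Σ (Fin 5 → Fin n) λ p → IsInducedPath G 5 p × p zero ≡ u × (∀ j → Near (p (suc j)))

  nearP₅-farP₄-inducedP₈ : ∀ {u x y z} → EndOfNearP₅ u → InducedP₄ G u x y z →
    Far x → Far y → Far z → Σ (Fin 8 → Fin n) (IsInducedPath G 8)
  nearP₅-farP₄-inducedP₈ (p , p-path , refl , near) P far-x far-y far-z =
    _ , InducedP₄-∷-isInducedPath G p-path P (away far-x) (away far-y) (away far-z)
    where
    away : ∀ {v} → Far v → ∀ j → adj G v (p (suc j)) ≡ false
    away far-v j = far-near-nonadj far-v (near j)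

  module NoFarP₄ {side} (bip : IsBipartition G side)
    (no-farP₄ : ∀ {u x y z} → Layer G N₀ 2 u → InducedP₄ G u x y z → Far x → Far y → Far z → ⊥) where

    private
      triangle-free : ∀ {x y z} → adj G x y ≡ true → adj G y z ≡ true → adj G x z ≡ false
      triangle-free = bipartite⇒triangle-free G bip

      far : ∀ {i v} → Layer G N₀ (3 + i) v → Far v
      far Lv = _ , s≤s (s≤s (s≤s z≤n)) , Lv

    N₅-empty : ∀ v → ¬ Layer G N₀ 5 v
    N₅-empty v L₅ with layer-parent L₅
    ... | _ , L₄ , v₄~v with layer-parent L₄
    ... | _ , L₃ , v₃~v₄ with layer-parent L₃
    ... | _ , L₂ , v₂~v₃ = no-farP₄ L₂
      (record { a~b = v₂~v₃ ; b~c = v₃~v₄ ; c~d = v₄~v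
              ; a≁c = layer-gap-nonadj L₂ L₄ ≤-refl
              ; a≁d = layer-gap-nonadj L₂ L₅ (n≤1+n 4)
              ; b≁d = layer-gap-nonadj L₃ L₅ ≤-refl })
      (far L₃) (far L₄) (far L₅)

    N₄-independent : ∀ a b → Layer G N₀ 4 a → Layer G N₀ 4 b → adj G a b ≡ false
    N₄-independent a b La Lb with layer-parent La
    ... | _ , L₃ , a₃~a with layer-parent L₃
    ... | _ , L₂ , a₂~a₃ = ¬-not λ a~b → no-farP₄ L₂
      (record { a~b = a₂~a₃ ; b~c = a₃~a ; c~d = a~b
              ; a≁c = layer-gap-nonadj L₂ La ≤-refl
              ; a≁d = layer-gap-nonadj L₂ Lb ≤-refl
              ; b≁d = triangle-free a₃~a a~b })
      (far L₃) (far La) (far Lb)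

    N₃-edge-N₄-nonadj : ∀ {a b c} → Layer G N₀ 3 a → Layer G N₀ 3 b → adj G a b ≡ true →
      Layer G N₀ 4 c → adj G a c ≡ false
    N₃-edge-N₄-nonadj {a} {b} La Lb a~b Lc with layer-parent Lb
    ... | _ , L₂ , b₂~b = ¬-not λ a~c → no-farP₄ L₂
      (record { a~b = b₂~b ; b~c = b~a ; c~d = a~c
              ; a≁c = triangle-free b₂~b b~a
              ; a≁d = layer-gap-nonadj L₂ Lc ≤-refl
              ; b≁d = triangle-free b~a a~c })
      (far Lb) (far La) (far Lc)
      where
      b~a : adj G b a ≡ true
      b~a = adj-sym G a~b

lemma1 : ∀ {n} (G : Graph n) (side : Fin n → Bool) → IsBipartition G side → PFree 8 G →
    (N₀ : Fin n → Bool) → (∃ λ v → N₀ v ≡ true) →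
    (∀ u → Layer G N₀ 2 u →
      Σ (Fin 5 → Fin n) λ p → IsInducedPath G 5 p × p zero ≡ u ×
        (∀ j → Layer G N₀ 0 (p (suc j)) ⊎ Layer G N₀ 1 (p (suc j)))) →
    (∀ u → Layer G N₀ 2 u →
      ¬ (Σ (Fin 4 → Fin n) λ p → IsInducedPath G 4 p × p zero ≡ u ×
          (∀ j → ∃ λ i → 3 ≤ i × Layer G N₀ i (p (suc j))))) ×
    (∀ v → ¬ Layer G N₀ 5 v) ×
    (∀ a b → Layer G N₀ 4 a → Layer G N₀ 4 b → adj G a b ≡ false) ×
    (∀ a b → Layer G N₀ 3 a → Layer G N₀ 3 b → adj G a b ≡ true →
      ∀ c → Layer G N₀ 4 c → adj G a c ≡ false × adj G b c ≡ false)
lemma1 G side bip P₈-free N₀ _ nearP₅ =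
  no-farP₄-path , N₅-empty , N₄-independent , λ a b La Lb a~b c Lc →
    N₃-edge-N₄-nonadj La Lb a~b Lc , N₃-edge-N₄-nonadj Lb La (adj-sym G a~b) Lc
  where
  no-farP₄ : ∀ {u x y z} → Layer G N₀ 2 u → InducedP₄ G u x y z →
    Far G N₀ x → Far G N₀ y → Far G N₀ z → ⊥
  no-farP₄ Lu P fx fy fz = P₈-free (nearP₅-farP₄-inducedP₈ G N₀ (nearP₅ _ Lu) P fx fy fz)

  no-farP₄-path : ∀ u → Layer G N₀ 2 u →
    ¬ (Σ (Fin 4 → Fin _) λ p → IsInducedPath G 4 p × p zero ≡ u × (∀ j → Far G N₀ (p (suc j))))
  no-farP₄-path u Lu (p , p-path , refl , far) =
    no-farP₄ Lu (isInducedPath⇒InducedP₄ G p-path) (far zero) (far (suc zero)) (far (suc (suc zero)))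

  open NoFarP₄ G N₀ bip no-farP₄
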